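{- Let $g(x),f(x)$ be formal power series with integer coefficients and $g(0)=f(0)=1$, let $a_{n,k}=[x^n]g(x)(xf(x))^k$, let $\phi(x)$ be the reversion of $x/f(x)$, and let $s(x)$ be the reversion of $\phi(x)f(\phi(x))$. Let $c(A;1)$ be the lower-triangular matrix with $(n,k)$ entry $a_{2n,n+k}$ and $c(A;2)$ the lower-triangular matrix with $(n,k)$ entry $a_{2n+1,n+k+1}$. Then $$c(A;1)^{ -1}\cdot c(A;2)=\left(\frac{x}{\phi(s(x))},\ x\right).$$
   Context: A Riordan array $(d(x),h(x))$, for formal power series $d,h$ with $d(0)\neq 0$, $h(0)=0$, $h'(0)\neq 0$, is the infinite lower-triangular matrix whose $(n,k)$ entry is $[x^n]d(x)h(x)^k$. Riordan arrays form a group under matrix multiplication, with $(d,h)\cdot(u,w)=(d(x)u(h(x)),w(h(x)))$ and $(d,h)^{ -1}=(1/d(\bar h),\bar h)$, where $\bar h$ is the reversion of $h$: the power series $u$ with $u(0)=0$ and $h(u(x))=x$. -}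

module Defs where

open import Data.Nat using (ℕ; zero; suc; _∸_; _≤_; _<_)
open import Data.Integer using (ℤ; 0ℤ; 1ℤ; _+_; _*_)
open import Data.Product using (_×_)
open import Relation.Binary.PropositionalEquality using (_≡_)

-- Formal power series with integer coefficients: n ↦ [x^n] a.
PS : Set
PS = ℕ → ℤ

sumTo : ℕ → (ℕ → ℤ) → ℤ
sumTo zero    t = t zero
sumTo (suc n) t = sumTo n t + t (suc n)

one : PS
one zero    = 1ℤ
one (suc _) = 0ℤ

X : PS
X zero          = 0ℤ
X (suc zero)    = 1ℤ
X (suc (suc _)) = 0ℤ

mul : PS → PS → PS
mul a b n = sumTo n (λ i → a i * b (n ∸ i))

xmul : PS → PS
xmul a zero    = 0ℤ
xmul a (suc n) = a n

pow : PS → ℕ → PS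
pow a zero    = one
pow a (suc k) = mul a (pow a k)

-- composition h(u(x)), meaningful when u(0) = 0:
-- [x^n] h(u) = Σ_{k=0}^{n} h_k [x^n] u^k
comp : PS → PS → PS
comp h u n = sumTo n (λ k → h k * pow u k n)

_≐_ : PS → PS → Set
a ≐ b = ∀ n → a n ≡ b n

IsReversion : PS → PS → Set
IsReversion h u = (u 0 ≡ 0ℤ) × (comp h u ≐ X)

Mat : Set
Mat = ℕ → ℕ → ℤ

LowerTriangular : Mat → Set
LowerTriangular M = ∀ n k → n < k → M n k ≡ 0ℤ

idMat : Mat
idMat zero    zero    = 1ℤ
idMat zero    (suc _) = 0ℤ
idMat (suc _) zero    = 0ℤ
idMat (suc n) (suc k) = idMat n k

-- product of lower-triangular matrices: (A·B)(n,k) = Σ_{j=0}^{n} A(n,j) B(j,k)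
matMul : Mat → Mat → Mat
matMul A B n k = sumTo n (λ j → A n j * B j k)

_≐ₘ_ : Mat → Mat → Set
A ≐ₘ B = ∀ n k → A n k ≡ B n k

-- Riordan array (d,h): entry (n,k) = [x^n] d(x) h(x)^k
riordan : PS → PS → Mat
riordan d h n k = mul d (pow h k) n

aEntry : PS → PS → Mat
aEntry g f = riordan g (xmul f)

cA1 : PS → PS → Mat
cA1 g f n k = aEntry g f (n Data.Nat.+ n) (n Data.Nat.+ k)

cA2 : PS → PS → Mat
cA2 g f n k = aEntry g f (suc (n Data.Nat.+ n)) (suc (n Data.Nat.+ k))

module Submission where

-- Put h = x f and u = φ ∘ s. As h ∘ φ = φ · (f ∘ φ), the series s reverses h ∘ φ, so u is a right
-- compositional inverse of h, and since u = x + … it is also a left inverse. Composing r u = x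
-- with h then gives x · r(h) = h, that is f = r(x f): r is the A-sequence of the Riordan array
-- (g, x f), so a_{n+1,k+1} = Σ_l r_l a_{n,k+l}. At n = 2i this says c(A;2) = c(A;1) · (r, x), and
-- multiplying on the left by c(A;1)⁻¹ gives the claim.

open import Defs
open import Data.Nat as ℕ using (ℕ; zero; suc; _∸_; _≤_; _<_; z≤n; s≤s)
import Data.Nat.Properties as NP
open import Data.Nat.Induction using (<-rec)
open import Data.Integer using (ℤ; 0ℤ; 1ℤ; _+_; _*_)
import Data.Integer.Properties as ZP
open import Data.Integer.Tactic.RingSolver using (solve-∀)
open import Algebra.Properties.CommutativeSemigroup ZP.+-commutativeSemigroup using (interchange)
open import Algebra.Properties.AbelianGroup ZP.+-0-abelianGroup using (∙-cancelˡ)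
open import Data.Empty using (⊥-elim)
open import Function using (_∘′_)
open import Data.Sum using (inj₁; inj₂)
open import Data.Product using (_,_)
open import Relation.Binary.PropositionalEquality
open import Relation.Nullary using (yes; no)

-- Finite sums

sumTo-cong : ∀ n {t u : ℕ → ℤ} → (∀ i → i ≤ n → t i ≡ u i) → sumTo n t ≡ sumTo n u
sumTo-cong zero    t≡u = t≡u 0 z≤n
sumTo-cong (suc n) t≡u =
  cong₂ _+_ (sumTo-cong n (λ i i≤n → t≡u i (NP.m≤n⇒m≤1+n i≤n))) (t≡u (suc n) NP.≤-refl)

sumTo-zero : ∀ n (t : ℕ → ℤ) → (∀ i → i ≤ n → t i ≡ 0ℤ) → sumTo n t ≡ 0ℤ
sumTo-zero n t t≡0 = trans (sumTo-cong n t≡0) (sumTo-0 n)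
  where
  sumTo-0 : ∀ n → sumTo n (λ _ → 0ℤ) ≡ 0ℤ
  sumTo-0 zero    = refl
  sumTo-0 (suc n) = cong (_+ 0ℤ) (sumTo-0 n)

sumTo-+ : ∀ n (t u : ℕ → ℤ) → sumTo n (λ i → t i + u i) ≡ sumTo n t + sumTo n u
sumTo-+ zero    t u = refl
sumTo-+ (suc n) t u =
  trans (cong (_+ (t (suc n) + u (suc n))) (sumTo-+ n t u))
        (interchange (sumTo n t) (sumTo n u) (t (suc n)) (u (suc n)))

*-distribˡ-sumTo : ∀ n c (t : ℕ → ℤ) → c * sumTo n t ≡ sumTo n (λ i → c * t i)
*-distribˡ-sumTo zero    c t = refl
*-distribˡ-sumTo (suc n) c t =
  trans (ZP.*-distribˡ-+ c (sumTo n t) (t (suc n))) (cong (_+ c * t (suc n)) (*-distribˡ-sumTo n c t))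

*-distribʳ-sumTo : ∀ n c (t : ℕ → ℤ) → sumTo n t * c ≡ sumTo n (λ i → t i * c)
*-distribʳ-sumTo n c t =
  trans (ZP.*-comm (sumTo n t) c)
        (trans (*-distribˡ-sumTo n c t) (sumTo-cong n (λ i _ → ZP.*-comm c (t i))))

sumTo-swap : ∀ n m (t : ℕ → ℕ → ℤ) →
             sumTo n (λ i → sumTo m (t i)) ≡ sumTo m (λ j → sumTo n (λ i → t i j))
sumTo-swap zero    m t = refl
sumTo-swap (suc n) m t = trans (cong (_+ sumTo m (t (suc n))) (sumTo-swap n m t)) (sym (sumTo-+ m _ _))

sumTo-single : ∀ n q (t : ℕ → ℤ) → q ≤ n → (∀ i → i ≤ n → i ≢ q → t i ≡ 0ℤ) →
               sumTo n t ≡ t q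
sumTo-single zero    .zero t z≤n _ = refl
sumTo-single (suc n) q     t q≤1+n t≡0 with q NP.≟ suc n
... | yes refl = trans (cong (_+ t (suc n))
                              (sumTo-zero n t (λ i i≤n → t≡0 i (NP.m≤n⇒m≤1+n i≤n) (NP.<⇒≢ (s≤s i≤n)))))
                       (ZP.+-identityˡ _)
... | no q≢1+n = trans (cong₂ _+_ (sumTo-single n q t (NP.≤-pred (NP.≤∧≢⇒< q≤1+n q≢1+n))
                                                 (λ i i≤n → t≡0 i (NP.m≤n⇒m≤1+n i≤n)))
                                  (t≡0 (suc n) NP.≤-refl (q≢1+n ∘′ sym)))
                       (ZP.+-identityʳ _)

sumTo-extend : ∀ {m n} (t : ℕ → ℤ) → m ≤ n → (∀ i → m < i → i ≤ n → t i ≡ 0ℤ) →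
               sumTo n t ≡ sumTo m t
sumTo-extend {n = zero}  t z≤n _ = refl
sumTo-extend {m} {suc n} t m≤1+n t≡0 with NP.m≤n⇒m<n∨m≡n m≤1+n
... | inj₂ refl        = refl
... | inj₁ (s≤s m≤n) =
  trans (cong₂ _+_ (sumTo-extend t m≤n (λ i m<i i≤n → t≡0 i m<i (NP.m≤n⇒m≤1+n i≤n)))
                   (t≡0 (suc n) (s≤s m≤n) NP.≤-refl))
        (ZP.+-identityʳ _)

sumTo-shift : ∀ k m (t : ℕ → ℤ) → (∀ j → j < k → t j ≡ 0ℤ) →
              sumTo (k ℕ.+ m) t ≡ sumTo m (λ l → t (k ℕ.+ l))
sumTo-shift k zero t t≡0 =
  sumTo-single (k ℕ.+ 0) (k ℕ.+ 0) t NP.≤-refl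
    (λ i i≤k+0 i≢k+0 → t≡0 i (subst (i <_) (NP.+-identityʳ k) (NP.≤∧≢⇒< i≤k+0 i≢k+0)))
sumTo-shift k (suc m) t t≡0 rewrite NP.+-suc k m = cong (_+ t (suc (k ℕ.+ m))) (sumTo-shift k m t t≡0)

sumTo-rotate₃ : ∀ n (G : ℕ → ℕ → ℕ → ℤ) →
  sumTo n (λ p → sumTo n (λ x → sumTo n (λ y → G p x y))) ≡
  sumTo n (λ x → sumTo n (λ y → sumTo n (λ p → G p x y)))
sumTo-rotate₃ n G = trans (sumTo-swap n n _) (sumTo-cong n (λ x _ → sumTo-swap n n _))

sumTo-rotate₄ : ∀ n (G : ℕ → ℕ → ℕ → ℕ → ℤ) →
  sumTo n (λ p → sumTo n (λ x → sumTo n (λ y → sumTo n (λ z → G p x y z)))) ≡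
  sumTo n (λ x → sumTo n (λ y → sumTo n (λ z → sumTo n (λ p → G p x y z))))
sumTo-rotate₄ n G = trans (sumTo-swap n n _) (sumTo-cong n (λ x _ → sumTo-rotate₃ n (λ p → G p x)))

*-distribˡ-sumTo₂ : ∀ n c (t : ℕ → ℕ → ℤ) →
  c * sumTo n (λ i → sumTo n (t i)) ≡ sumTo n (λ i → sumTo n (λ j → c * t i j))
*-distribˡ-sumTo₂ n c t = trans (*-distribˡ-sumTo n c _) (sumTo-cong n (λ i _ → *-distribˡ-sumTo n c (t i)))

*-distribʳ-sumTo₂ : ∀ n c (t : ℕ → ℕ → ℤ) →
  sumTo n (λ i → sumTo n (t i)) * c ≡ sumTo n (λ i → sumTo n (λ j → t i j * c))
*-distribʳ-sumTo₂ n c t = trans (*-distribʳ-sumTo n c _) (sumTo-cong n (λ i _ → *-distribʳ-sumTo n c (t i)))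

idMat-≡ : ∀ {p q} → p ≡ q → idMat p q ≡ 1ℤ
idMat-≡ {zero}  refl = refl
idMat-≡ {suc p} refl = idMat-≡ {p} refl

idMat-≢ : ∀ {p q} → p ≢ q → idMat p q ≡ 0ℤ
idMat-≢ {zero}  {zero}  p≢q = ⊥-elim (p≢q refl)
idMat-≢ {zero}  {suc q} _   = refl
idMat-≢ {suc p} {zero}  _   = refl
idMat-≢ {suc p} {suc q} p≢q = idMat-≢ (p≢q ∘′ cong suc)

idMat-> : ∀ {p q} → q < p → idMat p q ≡ 0ℤ
idMat-> q<p = idMat-≢ (NP.>⇒≢ q<p)

sumTo-idMat : ∀ n q (F : ℕ → ℤ) → (n < q → F q ≡ 0ℤ) → sumTo n (λ p → idMat q p * F p) ≡ F q
sumTo-idMat n q F Fq≡0 with q NP.≤? n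
... | yes q≤n = trans (sumTo-single n q _ q≤n (λ i _ i≢q → cong (_* F i) (idMat-≢ (i≢q ∘′ sym))))
                      (trans (cong (_* F q) (idMat-≡ {q} refl)) (ZP.*-identityˡ _))
... | no  q≰n = trans (sumTo-zero n _ (λ i i≤n → cong (_* F i) (idMat-≢ {q} {i} λ { refl → q≰n i≤n })))
                      (sym (Fq≡0 (NP.≰⇒> q≰n)))

-- Products of series

mul-cong : ∀ {a a′ b b′} → a ≐ a′ → b ≐ b′ → mul a b ≐ mul a′ b′
mul-cong a≐a′ b≐b′ n = sumTo-cong n (λ i _ → cong₂ _*_ (a≐a′ i) (b≐b′ (n ∸ i)))

mul-congʳ : ∀ a {b b′} → b ≐ b′ → mul a b ≐ mul a b′
mul-congʳ a = mul-cong {a} (λ _ → refl)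

-- Unlike the triangular sum defining mul, a square sum (i, j ≤ m) can be reordered freely.
mulUpTo : ℕ → PS → PS → ℕ → ℤ
mulUpTo m a b n = sumTo m (λ i → sumTo m (λ j → idMat (i ℕ.+ j) n * (a i * b j)))

mul≡mulUpTo : ∀ m n a b → n ≤ m → mul a b n ≡ mulUpTo m a b n
mul≡mulUpTo m n a b n≤m = sym (trans (sumTo-extend row n≤m row≡0) (sumTo-cong n row≡term))
  where
  row : ℕ → ℤ
  row i = sumTo m (λ j → idMat (i ℕ.+ j) n * (a i * b j))
  row≡0 : ∀ i → n < i → i ≤ m → row i ≡ 0ℤ
  row≡0 i n<i _ = sumTo-zero m _ (λ j _ → cong (_* (a i * b j)) (idMat-> (NP.<-≤-trans n<i (NP.m≤m+n i j))))
  row≡term : ∀ i → i ≤ n → row i ≡ a i * b (n ∸ i)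
  row≡term i i≤n =
    trans (sumTo-single m (n ∸ i) _ (NP.≤-trans (NP.m∸n≤m n i) n≤m)
             (λ j _ j≢n∸i → cong (_* (a i * b j))
               (idMat-≢ λ i+j≡n → j≢n∸i (trans (sym (NP.m+n∸m≡n i j)) (cong (_∸ i) i+j≡n)))))
          (trans (cong (_* (a i * b (n ∸ i))) (idMat-≡ (NP.m+[n∸m]≡n i≤n))) (ZP.*-identityˡ _))

mul-comm : ∀ a b → mul a b ≐ mul b a
mul-comm a b n =
  trans (mul≡mulUpTo n n a b NP.≤-refl)
  (trans (sumTo-swap n n _)
  (trans (sumTo-cong n (λ j _ → sumTo-cong n (λ i _ →
            cong₂ _*_ (cong (λ z → idMat z n) (NP.+-comm i j)) (ZP.*-comm (a i) (b j)))))
         (sym (mul≡mulUpTo n n b a NP.≤-refl))))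

tripleSum : ℕ → PS → PS → PS → ℤ
tripleSum n a b c =
  sumTo n (λ i → sumTo n (λ j → sumTo n (λ k → idMat ((i ℕ.+ j) ℕ.+ k) n * ((a i * b j) * c k))))

mul-mulˡ≡tripleSum : ∀ a b c n → mul (mul a b) c n ≡ tripleSum n a b c
mul-mulˡ≡tripleSum a b c n = begin
    mul (mul a b) c n
  ≡⟨ mul≡mulUpTo n n (mul a b) c NP.≤-refl ⟩
    sumTo n (λ p → sumTo n (λ k → idMat (p ℕ.+ k) n * (mul a b p * c k)))
  ≡⟨ sumTo-cong n (λ p p≤n → sumTo-cong n (λ k _ → expand p k p≤n)) ⟩
    sumTo n (λ p → sumTo n (λ k → sumTo n (λ i → sumTo n (λ j →
      idMat (p ℕ.+ k) n * ((idMat (i ℕ.+ j) p * (a i * b j)) * c k)))))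
  ≡⟨ trans (sumTo-cong n (λ p _ → sumTo-rotate₃ n _)) (sumTo-rotate₄ n _) ⟩
    sumTo n (λ i → sumTo n (λ j → sumTo n (λ k → sumTo n (λ p →
      idMat (p ℕ.+ k) n * ((idMat (i ℕ.+ j) p * (a i * b j)) * c k)))))
  ≡⟨ sumTo-cong n (λ i _ → sumTo-cong n (λ j _ → sumTo-cong n (λ k _ → collapse i j k))) ⟩
    tripleSum n a b c
  ∎
  where
  open ≡-Reasoning
  expand : ∀ p k → p ≤ n → idMat (p ℕ.+ k) n * (mul a b p * c k) ≡
    sumTo n (λ i → sumTo n (λ j → idMat (p ℕ.+ k) n * ((idMat (i ℕ.+ j) p * (a i * b j)) * c k)))
  expand p k p≤n =
    trans (cong (λ z → idMat (p ℕ.+ k) n * (z * c k)) (mul≡mulUpTo n p a b p≤n))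
    (trans (cong (idMat (p ℕ.+ k) n *_) (*-distribʳ-sumTo₂ n (c k) _))
           (*-distribˡ-sumTo₂ n (idMat (p ℕ.+ k) n) _))
  reorder : ∀ (x y z w v : ℤ) → x * ((y * (z * w)) * v) ≡ y * (x * ((z * w) * v))
  reorder = solve-∀
  collapse : ∀ i j k → sumTo n (λ p → idMat (p ℕ.+ k) n * ((idMat (i ℕ.+ j) p * (a i * b j)) * c k)) ≡
    idMat ((i ℕ.+ j) ℕ.+ k) n * ((a i * b j) * c k)
  collapse i j k =
    trans (sumTo-cong n (λ p _ → reorder (idMat (p ℕ.+ k) n) (idMat (i ℕ.+ j) p) (a i) (b j) (c k)))
          (sumTo-idMat n (i ℕ.+ j) _ (λ n<i+j →
            cong (_* ((a i * b j) * c k)) (idMat-> (NP.<-≤-trans n<i+j (NP.m≤m+n _ k)))))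

mul-mulʳ≡tripleSum : ∀ a b c n → mul a (mul b c) n ≡ tripleSum n a b c
mul-mulʳ≡tripleSum a b c n = begin
    mul a (mul b c) n
  ≡⟨ mul≡mulUpTo n n a (mul b c) NP.≤-refl ⟩
    sumTo n (λ i → sumTo n (λ q → idMat (i ℕ.+ q) n * (a i * mul b c q)))
  ≡⟨ sumTo-cong n (λ i _ → sumTo-cong n (λ q q≤n → expand i q q≤n)) ⟩
    sumTo n (λ i → sumTo n (λ q → sumTo n (λ j → sumTo n (λ k →
      idMat (i ℕ.+ q) n * (a i * (idMat (j ℕ.+ k) q * (b j * c k)))))))
  ≡⟨ sumTo-cong n (λ i _ → sumTo-rotate₃ n _) ⟩
    sumTo n (λ i → sumTo n (λ j → sumTo n (λ k → sumTo n (λ q →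
      idMat (i ℕ.+ q) n * (a i * (idMat (j ℕ.+ k) q * (b j * c k)))))))
  ≡⟨ sumTo-cong n (λ i _ → sumTo-cong n (λ j _ → sumTo-cong n (λ k _ → collapse i j k))) ⟩
    tripleSum n a b c
  ∎
  where
  open ≡-Reasoning
  expand : ∀ i q → q ≤ n → idMat (i ℕ.+ q) n * (a i * mul b c q) ≡
    sumTo n (λ j → sumTo n (λ k → idMat (i ℕ.+ q) n * (a i * (idMat (j ℕ.+ k) q * (b j * c k)))))
  expand i q q≤n =
    trans (cong (λ z → idMat (i ℕ.+ q) n * (a i * z)) (mul≡mulUpTo n q b c q≤n))
    (trans (cong (idMat (i ℕ.+ q) n *_) (*-distribˡ-sumTo₂ n (a i) _))
           (*-distribˡ-sumTo₂ n (idMat (i ℕ.+ q) n) _))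
  reorder : ∀ (x y z w v : ℤ) → x * (z * (y * (w * v))) ≡ y * (x * ((z * w) * v))
  reorder = solve-∀
  collapse : ∀ i j k → sumTo n (λ q → idMat (i ℕ.+ q) n * (a i * (idMat (j ℕ.+ k) q * (b j * c k)))) ≡
    idMat ((i ℕ.+ j) ℕ.+ k) n * ((a i * b j) * c k)
  collapse i j k =
    trans (sumTo-cong n (λ q _ → reorder (idMat (i ℕ.+ q) n) (idMat (j ℕ.+ k) q) (a i) (b j) (c k)))
    (trans (sumTo-idMat n (j ℕ.+ k) _ (λ n<j+k →
             cong (_* ((a i * b j) * c k)) (idMat-> (NP.<-≤-trans n<j+k (NP.m≤n+m _ i)))))
           (cong (λ z → idMat z n * ((a i * b j) * c k)) (sym (NP.+-assoc i j k))))

mul-assoc : ∀ a b c → mul (mul a b) c ≐ mul a (mul b c)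
mul-assoc a b c n = trans (mul-mulˡ≡tripleSum a b c n) (sym (mul-mulʳ≡tripleSum a b c n))

mul-identityˡ : ∀ b → mul one b ≐ b
mul-identityˡ b n =
  trans (sumTo-single n 0 _ z≤n (λ { zero _ 0≢0 → ⊥-elim (0≢0 refl) ; (suc i) _ _ → refl }))
        (ZP.*-identityˡ (b n))

mul-identityʳ : ∀ a → mul a one ≐ a
mul-identityʳ a n = trans (mul-comm a one n) (mul-identityˡ a n)

X-mul : ∀ b → mul X b ≐ xmul b
X-mul b zero    = refl
X-mul b (suc n) =
  trans (sumTo-single (suc n) 1 _ (s≤s z≤n)
          (λ { zero _ _ → refl ; (suc zero) _ 1≢1 → ⊥-elim (1≢1 refl) ; (suc (suc i)) _ _ → refl }))
        (ZP.*-identityˡ (b n))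

mul-X : ∀ a → mul a X ≐ xmul a
mul-X a n = trans (mul-comm a X n) (X-mul a n)

mul-xmul : ∀ a b → mul a (xmul b) ≐ xmul (mul a b)
mul-xmul a b n = begin
    mul a (xmul b) n  ≡⟨ mul-congʳ a (λ m → sym (X-mul b m)) n ⟩
    mul a (mul X b) n ≡⟨ sym (mul-assoc a X b n) ⟩
    mul (mul a X) b n ≡⟨ mul-cong {mul a X} {mul X a} {b} (mul-comm a X) (λ _ → refl) n ⟩
    mul (mul X a) b n ≡⟨ mul-assoc X a b n ⟩
    mul X (mul a b) n ≡⟨ X-mul (mul a b) n ⟩
    xmul (mul a b) n  ∎
  where open ≡-Reasoning

pow-cong : ∀ {a b} → a ≐ b → ∀ k → pow a k ≐ pow b k
pow-cong a≐b zero    n = refl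
pow-cong a≐b (suc k)   = mul-cong a≐b (pow-cong a≐b k)

pow-+ : ∀ u i j → pow u (i ℕ.+ j) ≐ mul (pow u i) (pow u j)
pow-+ u zero    j n = sym (mul-identityˡ (pow u j) n)
pow-+ u (suc i) j n = trans (mul-congʳ u (pow-+ u i j) n) (sym (mul-assoc u (pow u i) (pow u j) n))

pow-X : ∀ k n → pow X k n ≡ idMat k n
pow-X zero    zero    = refl
pow-X zero    (suc n) = refl
pow-X (suc k) zero    = X-mul (pow X k) 0
pow-X (suc k) (suc n) = trans (X-mul (pow X k) (suc n)) (pow-X k n)

mul-pow-X : ∀ a k l → mul a (pow X k) (k ℕ.+ l) ≡ a l
mul-pow-X a zero    l = mul-identityʳ a l
mul-pow-X a (suc k) l =
  trans (mul-congʳ a (X-mul (pow X k)) (suc (k ℕ.+ l)))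
  (trans (mul-xmul a (pow X k) (suc (k ℕ.+ l))) (mul-pow-X a k l))

mul-vanishes-below : ∀ {p} a w → (∀ q → q < p → w q ≡ 0ℤ) → ∀ n → n < p → mul a w n ≡ 0ℤ
mul-vanishes-below a w w≡0 n n<p =
  sumTo-zero n _ (λ i _ → trans (cong (a i *_) (w≡0 _ (NP.≤-<-trans (NP.m∸n≤m n i) n<p))) (ZP.*-zeroʳ (a i)))

pow-vanishes-below : ∀ {u} → u 0 ≡ 0ℤ → ∀ k n → n < k → pow u k n ≡ 0ℤ
pow-vanishes-below {u} u0 (suc k) n (s≤s n≤k) = sumTo-zero n _ (term≡0 n n≤k)
  where
  term≡0 : ∀ n → n ≤ k → ∀ i → i ≤ n → u i * pow u k (n ∸ i) ≡ 0ℤ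
  term≡0 n       _         zero    _         = cong (_* pow u k n) u0
  term≡0 (suc n) 1+n≤k (suc i) (s≤s i≤n) =
    trans (cong (u (suc i) *_) (pow-vanishes-below u0 k (n ∸ i) (NP.≤-<-trans (NP.m∸n≤m n i) 1+n≤k)))
          (ZP.*-zeroʳ (u (suc i)))

pow-diagonal : ∀ {u} → u 0 ≡ 0ℤ → u 1 ≡ 1ℤ → ∀ n → pow u n n ≡ 1ℤ
pow-diagonal u0 u1 zero    = refl
pow-diagonal {u} u0 u1 (suc n) =
  trans (sumTo-single (suc n) 1 _ (s≤s z≤n) term≡0) (cong₂ _*_ u1 (pow-diagonal u0 u1 n))
  where
  term≡0 : ∀ i → i ≤ suc n → i ≢ 1 → u i * pow u n (suc n ∸ i) ≡ 0ℤ
  term≡0 zero          _         _   = cong (_* pow u n (suc n)) u0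
  term≡0 (suc zero)    _         1≢1 = ⊥-elim (1≢1 refl)
  term≡0 (suc (suc i)) (s≤s i<n) _   =
    trans (cong (u (suc (suc i)) *_) (pow-vanishes-below u0 n (n ∸ suc i) (NP.∸-monoʳ-< (s≤s z≤n) i<n)))
          (ZP.*-zeroʳ (u (suc (suc i))))

-- Composition of series

comp-cong : ∀ {a a′ u u′} → a ≐ a′ → u ≐ u′ → comp a u ≐ comp a′ u′
comp-cong a≐a′ u≐u′ n = sumTo-cong n (λ k _ → cong₂ _*_ (a≐a′ k) (pow-cong u≐u′ k n))

comp-congˡ : ∀ {a a′} u → a ≐ a′ → comp a u ≐ comp a′ u
comp-congˡ {a} {a′} u a≐a′ = comp-cong {a} {a′} {u} a≐a′ (λ _ → refl)

comp-at-0 : ∀ a u → comp a u 0 ≡ a 0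
comp-at-0 a u = ZP.*-identityʳ (a 0)

comp-extend : ∀ {u} a → u 0 ≡ 0ℤ → ∀ {n m} → n ≤ m → comp a u n ≡ sumTo m (λ k → a k * pow u k n)
comp-extend {u} a u0 {n} n≤m =
  sym (sumTo-extend _ n≤m (λ k n<k _ → trans (cong (a k *_) (pow-vanishes-below u0 k n n<k)) (ZP.*-zeroʳ (a k))))

comp-identityˡ : ∀ {u} → u 0 ≡ 0ℤ → comp X u ≐ u
comp-identityˡ u0 zero = sym u0
comp-identityˡ {u} u0 (suc n) =
  trans (sumTo-single (suc n) 1 _ (s≤s z≤n)
          (λ { zero _ _ → refl ; (suc zero) _ 1≢1 → ⊥-elim (1≢1 refl) ; (suc (suc i)) _ _ → refl }))
        (trans (ZP.*-identityˡ _) (mul-identityʳ u (suc n)))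

comp-identityʳ : ∀ a → comp a X ≐ a
comp-identityʳ a n =
  trans (sumTo-single n n _ NP.≤-refl
          (λ k _ k≢n → trans (cong (a k *_) (trans (pow-X k n) (idMat-≢ k≢n))) (ZP.*-zeroʳ (a k))))
        (trans (cong (a n *_) (trans (pow-X n n) (idMat-≡ {n} refl))) (ZP.*-identityʳ (a n)))

comp-one : ∀ u → comp one u ≐ one
comp-one u n =
  trans (sumTo-single n 0 _ z≤n (λ { zero _ 0≢0 → ⊥-elim (0≢0 refl) ; (suc k) _ _ → refl }))
        (ZP.*-identityˡ _)

mul-comp : ∀ {h} a r → h 0 ≡ 0ℤ → ∀ n → mul a (comp r h) n ≡ sumTo n (λ l → r l * mul a (pow h l) n)
mul-comp {h} a r h0 n = begin
    sumTo n (λ i → a i * comp r h (n ∸ i))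
  ≡⟨ sumTo-cong n (λ i _ → trans (cong (a i *_) (comp-extend r h0 (NP.m∸n≤m n i)))
                                 (*-distribˡ-sumTo n (a i) _)) ⟩
    sumTo n (λ i → sumTo n (λ l → a i * (r l * pow h l (n ∸ i))))
  ≡⟨ sumTo-swap n n _ ⟩
    sumTo n (λ l → sumTo n (λ i → a i * (r l * pow h l (n ∸ i))))
  ≡⟨ sumTo-cong n (λ l _ → trans (sumTo-cong n (λ i _ → swap (a i) (r l) _))
                                 (sym (*-distribˡ-sumTo n (r l) _))) ⟩
    sumTo n (λ l → r l * mul a (pow h l) n)
  ∎
  where
  open ≡-Reasoning
  swap : ∀ (x y z : ℤ) → x * (y * z) ≡ y * (x * z)
  swap = solve-∀

comp-mul : ∀ {u} a b → u 0 ≡ 0ℤ → comp (mul a b) u ≐ mul (comp a u) (comp b u)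
comp-mul {u} a b u0 n = trans lhs (sym rhs)
  where
  open ≡-Reasoning
  P = pow u
  lhs : comp (mul a b) u n ≡ sumTo n (λ i → sumTo n (λ j → (a i * b j) * P (i ℕ.+ j) n))
  lhs = begin
      sumTo n (λ k → mul a b k * P k n)
    ≡⟨ sumTo-cong n (λ k k≤n → trans (cong (_* P k n) (mul≡mulUpTo n k a b k≤n))
                                     (*-distribʳ-sumTo₂ n (P k n) _)) ⟩
      sumTo n (λ k → sumTo n (λ i → sumTo n (λ j → (idMat (i ℕ.+ j) k * (a i * b j)) * P k n)))
    ≡⟨ sumTo-rotate₃ n _ ⟩
      sumTo n (λ i → sumTo n (λ j → sumTo n (λ k → (idMat (i ℕ.+ j) k * (a i * b j)) * P k n)))
    ≡⟨ sumTo-cong n (λ i _ → sumTo-cong n (λ j _ → collapse i j)) ⟩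
      sumTo n (λ i → sumTo n (λ j → (a i * b j) * P (i ℕ.+ j) n))
    ∎
    where
    reorder : ∀ (x a b p : ℤ) → (x * (a * b)) * p ≡ x * ((a * b) * p)
    reorder = solve-∀
    collapse : ∀ i j → sumTo n (λ k → (idMat (i ℕ.+ j) k * (a i * b j)) * P k n) ≡
                       (a i * b j) * P (i ℕ.+ j) n
    collapse i j =
      trans (sumTo-cong n (λ k _ → reorder (idMat (i ℕ.+ j) k) (a i) (b j) (P k n)))
            (sumTo-idMat n (i ℕ.+ j) _ (λ n<i+j →
              trans (cong ((a i * b j) *_) (pow-vanishes-below u0 _ n n<i+j)) (ZP.*-zeroʳ (a i * b j))))
  rhs : mul (comp a u) (comp b u) n ≡ sumTo n (λ i → sumTo n (λ j → (a i * b j) * P (i ℕ.+ j) n))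
  rhs = begin
      mul (comp a u) (comp b u) n
    ≡⟨ mul≡mulUpTo n n (comp a u) (comp b u) NP.≤-refl ⟩
      sumTo n (λ p → sumTo n (λ q → idMat (p ℕ.+ q) n * (comp a u p * comp b u q)))
    ≡⟨ sumTo-cong n (λ p p≤n → sumTo-cong n (λ q q≤n → expand p q p≤n q≤n)) ⟩
      sumTo n (λ p → sumTo n (λ q → sumTo n (λ i → sumTo n (λ j →
        idMat (p ℕ.+ q) n * ((a i * P i p) * (b j * P j q))))))
    ≡⟨ trans (sumTo-rotate₄ n _) (sumTo-rotate₄ n _) ⟩
      sumTo n (λ i → sumTo n (λ j → sumTo n (λ p → sumTo n (λ q →
        idMat (p ℕ.+ q) n * ((a i * P i p) * (b j * P j q))))))
    ≡⟨ sumTo-cong n (λ i _ → sumTo-cong n (λ j _ → factor i j)) ⟩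
      sumTo n (λ i → sumTo n (λ j → (a i * b j) * mulUpTo n (P i) (P j) n))
    ≡⟨ sumTo-cong n (λ i _ → sumTo-cong n (λ j _ → cong ((a i * b j) *_)
         (trans (sym (mul≡mulUpTo n n (P i) (P j) NP.≤-refl)) (sym (pow-+ u i j n))))) ⟩
      sumTo n (λ i → sumTo n (λ j → (a i * b j) * P (i ℕ.+ j) n))
    ∎
    where
    expand : ∀ p q → p ≤ n → q ≤ n → idMat (p ℕ.+ q) n * (comp a u p * comp b u q) ≡
      sumTo n (λ i → sumTo n (λ j → idMat (p ℕ.+ q) n * ((a i * P i p) * (b j * P j q))))
    expand p q p≤n q≤n =
      trans (cong₂ (λ y z → idMat (p ℕ.+ q) n * (y * z)) (comp-extend a u0 p≤n) (comp-extend b u0 q≤n))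
      (trans (cong (idMat (p ℕ.+ q) n *_)
               (trans (*-distribʳ-sumTo n _ _) (sumTo-cong n (λ i _ → *-distribˡ-sumTo n (a i * P i p) _))))
             (*-distribˡ-sumTo₂ n (idMat (p ℕ.+ q) n) _))
    reorder : ∀ (x a p b q : ℤ) → x * ((a * p) * (b * q)) ≡ (a * b) * (x * (p * q))
    reorder = solve-∀
    factor : ∀ i j → sumTo n (λ p → sumTo n (λ q → idMat (p ℕ.+ q) n * ((a i * P i p) * (b j * P j q)))) ≡
      (a i * b j) * mulUpTo n (P i) (P j) n
    factor i j =
      trans (sumTo-cong n (λ p _ →
              trans (sumTo-cong n (λ q _ → reorder (idMat (p ℕ.+ q) n) (a i) (P i p) (b j) (P j q)))
                    (sym (*-distribˡ-sumTo n (a i * b j) _))))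
            (sym (*-distribˡ-sumTo n (a i * b j) _))

comp-pow : ∀ {v} u → v 0 ≡ 0ℤ → ∀ i → comp (pow u i) v ≐ pow (comp u v) i
comp-pow     u v0 zero        = comp-one _
comp-pow {v} u v0 (suc i) n =
  trans (comp-mul u (pow u i) v0 n) (mul-congʳ (comp u v) (comp-pow u v0 i) n)

comp-assoc : ∀ {u v} a → u 0 ≡ 0ℤ → v 0 ≡ 0ℤ → comp (comp a u) v ≐ comp a (comp u v)
comp-assoc {u} {v} a u0 v0 n = begin
    sumTo n (λ k → comp a u k * pow v k n)
  ≡⟨ sumTo-cong n (λ k k≤n → trans (cong (_* pow v k n) (comp-extend a u0 k≤n)) (*-distribʳ-sumTo n _ _)) ⟩
    sumTo n (λ k → sumTo n (λ i → (a i * pow u i k) * pow v k n))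
  ≡⟨ sumTo-swap n n _ ⟩
    sumTo n (λ i → sumTo n (λ k → (a i * pow u i k) * pow v k n))
  ≡⟨ sumTo-cong n (λ i _ → trans (sumTo-cong n (λ k _ → ZP.*-assoc (a i) _ _))
                                 (sym (*-distribˡ-sumTo n (a i) _))) ⟩
    sumTo n (λ i → a i * comp (pow u i) v n)
  ≡⟨ sumTo-cong n (λ i _ → cong (a i *_) (comp-pow u v0 i n)) ⟩
    comp a (comp u v) n
  ∎
  where open ≡-Reasoning

-- Since u^n = x^n + …, the coefficient of x^n in a ∘ u is a n plus terms involving only a k with k < n.
comp-injective : ∀ {u a b} → u 0 ≡ 0ℤ → u 1 ≡ 1ℤ → comp a u ≐ comp b u → a ≐ b
comp-injective {u} {a} {b} u0 u1 a∘u≐b∘u = <-rec (λ n → a n ≡ b n) step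
  where
  leading : ∀ c n → c n * pow u n n ≡ c n
  leading c n = trans (cong (c n *_) (pow-diagonal u0 u1 n)) (ZP.*-identityʳ (c n))
  step : ∀ n → (∀ {k} → k < n → a k ≡ b k) → a n ≡ b n
  step zero    _  = trans (sym (leading a 0)) (trans (a∘u≐b∘u 0) (leading b 0))
  step (suc n) ih =
    trans (sym (leading a (suc n)))
    (trans (∙-cancelˡ (sumTo n (λ k → b k * pow u k (suc n))) _ _
             (trans (cong (_+ a (suc n) * pow u (suc n) (suc n))
                       (sumTo-cong n (λ k k≤n → cong (_* pow u k (suc n)) (sym (ih (s≤s k≤n))))))
                    (a∘u≐b∘u (suc n))))
           (leading b (suc n)))

comp-xmul : ∀ {u} f → u 0 ≡ 0ℤ → comp (xmul f) u ≐ mul u (comp f u)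
comp-xmul {u} f u0 n =
  trans (comp-congˡ u (λ m → sym (X-mul f m)) n)
  (trans (comp-mul X f u0 n) (mul-cong {comp X u} {u} {comp f u} (comp-identityˡ u0) (λ _ → refl) n))

reversion-isLeftInverse : ∀ {h u} → h 0 ≡ 0ℤ → h 1 ≡ 1ℤ → IsReversion h u → comp u h ≐ X
reversion-isLeftInverse {h} {u} h0 h1 (u0 , h∘u≐X) = comp-injective u0 u1 (λ n → begin
    comp (comp u h) u n  ≡⟨ comp-assoc u h0 u0 n ⟩
    comp u (comp h u) n  ≡⟨ comp-cong {u} {u} {comp h u} {X} (λ _ → refl) h∘u≐X n ⟩
    comp u X n           ≡⟨ comp-identityʳ u n ⟩
    u n                  ≡⟨ sym (comp-identityˡ u0 n) ⟩
    comp X u n           ∎)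
  where
  open ≡-Reasoning
  u1 : u 1 ≡ 1ℤ
  u1 = begin
    u 1                          ≡⟨ sym (mul-identityʳ u 1) ⟩
    pow u 1 1                    ≡⟨ sym (ZP.*-identityˡ _) ⟩
    1ℤ * pow u 1 1               ≡⟨ cong (_* pow u 1 1) (sym h1) ⟩
    h 1 * pow u 1 1              ≡⟨ sym (ZP.+-identityˡ _) ⟩
    0ℤ + h 1 * pow u 1 1         ≡⟨ cong (_+ h 1 * pow u 1 1) (sym (ZP.*-zeroʳ (h 0))) ⟩
    h 0 * 0ℤ + h 1 * pow u 1 1   ≡⟨ h∘u≐X 1 ⟩
    1ℤ                           ∎

xmul-comp-quotient : ∀ {r u h} → h 0 ≡ 0ℤ → mul r u ≐ X → comp u h ≐ X → xmul (comp r h) ≐ h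
xmul-comp-quotient {r} {u} {h} h0 r·u≐X u∘h≐X n = begin
    xmul (comp r h) n            ≡⟨ sym (mul-X (comp r h) n) ⟩
    mul (comp r h) X n           ≡⟨ mul-congʳ (comp r h) (λ m → sym (u∘h≐X m)) n ⟩
    mul (comp r h) (comp u h) n  ≡⟨ sym (comp-mul r u h0 n) ⟩
    comp (mul r u) h n           ≡⟨ comp-congˡ h r·u≐X n ⟩
    comp X h n                   ≡⟨ comp-identityˡ h0 n ⟩
    h n                          ∎
  where open ≡-Reasoning

-- Riordan arrays

riordan-vanishes-above-diagonal : ∀ d h → h 0 ≡ 0ℤ → ∀ {n k} → n < k → riordan d h n k ≡ 0ℤ
riordan-vanishes-above-diagonal d h h0 {n} {k} =
  mul-vanishes-below d (pow h k) (pow-vanishes-below h0 k) n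

aEntry-Asequence : ∀ g f r → comp r (xmul f) ≐ f → ∀ n k →
  aEntry g f (suc n) (suc k) ≡ sumTo n (λ l → r l * aEntry g f n (k ℕ.+ l))
aEntry-Asequence g f r r∘h≐f n k = begin
    mul g (mul h (pow h k)) (suc n)  ≡⟨ mul-congʳ g (mul-comm h (pow h k)) (suc n) ⟩
    mul g (mul (pow h k) h) (suc n)  ≡⟨ sym (mul-assoc g (pow h k) h (suc n)) ⟩
    mul G h (suc n)                  ≡⟨ mul-xmul G f (suc n) ⟩
    mul G f n                        ≡⟨ mul-congʳ G (λ q → sym (r∘h≐f q)) n ⟩
    mul G (comp r h) n               ≡⟨ mul-comp G r refl n ⟩
    sumTo n (λ l → r l * mul G (pow h l) n)
  ≡⟨ sumTo-cong n (λ l _ → cong (r l *_)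
       (trans (mul-assoc g (pow h k) (pow h l) n) (mul-congʳ g (λ q → sym (pow-+ h k l q)) n))) ⟩
    sumTo n (λ l → r l * mul g (pow h (k ℕ.+ l)) n)
  ∎
  where
  open ≡-Reasoning
  h = xmul f
  G = mul g (pow h k)

cA1-lowerTriangular : ∀ g f → LowerTriangular (cA1 g f)
cA1-lowerTriangular g f i j i<j = riordan-vanishes-above-diagonal g (xmul f) refl (NP.+-monoʳ-< i i<j)

cA2≐cA1·riordan : ∀ g f r → comp r (xmul f) ≐ f → cA2 g f ≐ₘ matMul (cA1 g f) (riordan r X)
cA2≐cA1·riordan g f r r∘h≐f i k with k NP.≤? i
... | yes k≤i = subst (λ i → cA2 g f i k ≡ matMul (cA1 g f) (riordan r X) i k)
                      (NP.m+[n∸m]≡n k≤i) (onOrBelowDiagonal (i ∸ k))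
  where
  open ≡-Reasoning
  onOrBelowDiagonal : ∀ m → let I = k ℕ.+ m in cA2 g f I k ≡ matMul (cA1 g f) (riordan r X) I k
  onOrBelowDiagonal m = begin
      cA2 g f I k
    ≡⟨ aEntry-Asequence g f r r∘h≐f (I ℕ.+ I) (I ℕ.+ k) ⟩
      sumTo (I ℕ.+ I) (λ l → r l * aEntry g f (I ℕ.+ I) ((I ℕ.+ k) ℕ.+ l))
    ≡⟨ sumTo-extend _ (NP.≤-trans (NP.m≤n+m m k) (NP.m≤m+n I I)) (λ l m<l _ →
         trans (cong (r l *_) (riordan-vanishes-above-diagonal g (xmul f) refl
                 (subst (I ℕ.+ I <_) (sym (NP.+-assoc I k l)) (NP.+-monoʳ-< I (NP.+-monoʳ-< k m<l)))))
               (ZP.*-zeroʳ (r l))) ⟩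
      sumTo m (λ l → r l * aEntry g f (I ℕ.+ I) ((I ℕ.+ k) ℕ.+ l))
    ≡⟨ sumTo-cong m (λ l _ → trans (ZP.*-comm (r l) _)
         (cong₂ _*_ (cong (aEntry g f (I ℕ.+ I)) (NP.+-assoc I k l)) (sym (mul-pow-X r k l)))) ⟩
      sumTo m (λ l → cA1 g f I (k ℕ.+ l) * riordan r X (k ℕ.+ l) k)
    ≡⟨ sym (sumTo-shift k m _ (λ j j<k →
         trans (cong (cA1 g f I j *_) (riordan-vanishes-above-diagonal r X refl j<k)) (ZP.*-zeroʳ (cA1 g f I j)))) ⟩
      matMul (cA1 g f) (riordan r X) I k
    ∎
    where I = k ℕ.+ m
... | no k≰i =
  trans (riordan-vanishes-above-diagonal g (xmul f) refl (s≤s (NP.+-monoʳ-< i i<k)))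
        (sym (sumTo-zero i _ (λ j j≤i →
          trans (cong (cA1 g f i j *_) (riordan-vanishes-above-diagonal r X refl (NP.≤-<-trans j≤i i<k)))
                (ZP.*-zeroʳ (cA1 g f i j)))))
  where i<k = NP.≰⇒> k≰i

-- Products of lower-triangular matrices

matMul-cong : ∀ {A A′ B B′} → A ≐ₘ A′ → B ≐ₘ B′ → matMul A B ≐ₘ matMul A′ B′
matMul-cong A≐A′ B≐B′ n k = sumTo-cong n (λ j _ → cong₂ _*_ (A≐A′ n j) (B≐B′ j k))

matMul-identityˡ : ∀ C → matMul idMat C ≐ₘ C
matMul-identityˡ C n k = sumTo-idMat n n (λ j → C j k) (λ n<n → ⊥-elim (NP.<-irrefl refl n<n))

matMul-assoc : ∀ A {B} C → LowerTriangular B → matMul A (matMul B C) ≐ₘ matMul (matMul A B) C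
matMul-assoc A {B} C B-lower n k = begin
    sumTo n (λ i → A n i * sumTo i (λ j → B i j * C j k))
  ≡⟨ sumTo-cong n (λ i i≤n → cong (A n i *_)
       (sym (sumTo-extend _ i≤n (λ j i<j _ → cong (_* C j k) (B-lower i j i<j))))) ⟩
    sumTo n (λ i → A n i * sumTo n (λ j → B i j * C j k))
  ≡⟨ sumTo-cong n (λ i _ → *-distribˡ-sumTo n (A n i) _) ⟩
    sumTo n (λ i → sumTo n (λ j → A n i * (B i j * C j k)))
  ≡⟨ sumTo-swap n n _ ⟩
    sumTo n (λ j → sumTo n (λ i → A n i * (B i j * C j k)))
  ≡⟨ sumTo-cong n (λ j _ → trans (sumTo-cong n (λ i _ → sym (ZP.*-assoc (A n i) (B i j) (C j k))))
                                 (sym (*-distribʳ-sumTo n (C j k) _))) ⟩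
    sumTo n (λ j → matMul A B n j * C j k)
  ∎
  where open ≡-Reasoning

mainTheorem10 :
    (g f : PS) → g 0 ≡ 1ℤ → f 0 ≡ 1ℤ →
    -- finv = 1/f, so x/f(x) = xmul finv
    (finv : PS) → mul f finv ≐ one →
    -- φ = reversion of x/f(x)
    (φ : PS) → IsReversion (xmul finv) φ →
    -- s = reversion of φ(x) f(φ(x))
    (s : PS) → IsReversion (mul φ (comp f φ)) s →
    -- r = x/φ(s(x)), i.e. r · φ(s(x)) = x
    (r : PS) → mul r (comp φ s) ≐ X →
    -- M = c(A;1)⁻¹ (the inverse in the group of lower-triangular matrices)
    (M : Mat) → LowerTriangular M → matMul M (cA1 g f) ≐ₘ idMat →
    matMul M (cA2 g f) ≐ₘ riordan r X
mainTheorem10 g f _ f0 _ _ φ (φ0 , _) s (s0 , s-reverses) r r·u≐X M _ M·c1≐I n k = begin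
    matMul M (cA2 g f) n k             ≡⟨ matMul-cong {M} (λ _ _ → refl) (cA2≐cA1·riordan g f r r∘h≐f) n k ⟩
    matMul M (matMul (cA1 g f) T) n k  ≡⟨ matMul-assoc M T (cA1-lowerTriangular g f) n k ⟩
    matMul (matMul M (cA1 g f)) T n k  ≡⟨ matMul-cong {B = T} M·c1≐I (λ _ _ → refl) n k ⟩
    matMul idMat T n k                 ≡⟨ matMul-identityˡ T n k ⟩
    T n k                              ∎
  where
  open ≡-Reasoning
  h = xmul f
  u = comp φ s
  T = riordan r X
  u-reverses-h : IsReversion h u
  u-reverses-h = trans (comp-at-0 φ s) φ0 , λ n →
    trans (sym (comp-assoc {φ} {s} h φ0 s0 n)) (trans (comp-congˡ s (comp-xmul {φ} f φ0) n) (s-reverses n))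
  u∘h≐X : comp u h ≐ X
  u∘h≐X = reversion-isLeftInverse {h} {u} refl f0 u-reverses-h
  r∘h≐f : comp r h ≐ f
  r∘h≐f n = xmul-comp-quotient {r} {u} {h} refl r·u≐X u∘h≐X (suc n)
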